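{- Let $t\ge 1$ be an integer. Then $\chi_p(P_{3t}\Diamond_3 C_6)\le 4$ if $1\le t\le 2$, and $\chi_p(P_{3t}\Diamond_3 C_6)\le 5$ if $t\ge 3$. Moreover, equality holds for $t\in\{1,2\}$.
   Context: A packing $k$-coloring of a graph $H$ is a map $c:V(H)\to\{1,\ldots,k\}$ such that any two distinct vertices $u,v$ with $c(u)=c(v)=i$ satisfy $d_H(u,v)\ge i+1$. The packing chromatic number $\chi_p(H)$ is the least such $k$. $P_m$ denotes the path $v_1\cdots v_m$ and $C_n$ the cycle on $n$ vertices. Path-aligned product: for positive integers $\ell\mid m$ and a connected vertex-transitive graph $G$ containing $P_\ell$ as a subgraph, $P_m\Diamond_\ell G$ is formed from the path $P_m=v_1\cdots v_m$ and $m/\ell$ pairwise disjoint copies of $G$, where for each $1\le i\le m/\ell$ the consecutive path vertices $v_{(i-1)\ell+1},\ldots,v_{i\ell}$ are identified, in order, with the vertices of a path $P_\ell$ (i.e. $\ell$ consecutive cycle vertices when $G$ is a cycle) in the $i$-th copy of $G$. -}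

module Defs where

open import Data.Nat using (ℕ; zero; suc; _≤_; _<_)
open import Data.Fin using (Fin; toℕ)
open import Data.Fin.Base using () renaming (zero to f0; suc to fs)
open import Data.Product using (Σ; _×_; _,_)
open import Data.Sum using (_⊎_)
open import Relation.Binary.PropositionalEquality using (_≡_; _≢_)
open import Relation.Nullary using (¬_)

record Graph : Set₁ where
  field
    V   : Set
    Arc : V → V → Set

  Adj : V → V → Set
  Adj u v = Arc u v ⊎ Arc v u

data Walk (G : Graph) : Graph.V G → Graph.V G → ℕ → Set where
  nil  : ∀ {u} → Walk G u u 0
  cons : ∀ {u w v n} → Graph.Adj G u w → Walk G w v n → Walk G u v (suc n)

-- d_G(u,v) ≥ d  iff there is no walk (equivalently path) from u to v of length < d.
DistGE : (G : Graph) → Graph.V G → Graph.V G → ℕ → Set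
DistGE G u v d = ∀ n → n < d → ¬ Walk G u v n

record PackingColoring (G : Graph) (k : ℕ) : Set where
  field
    c       : Graph.V G → ℕ
    c-pos   : ∀ v → 1 ≤ c v
    c-bound : ∀ v → c v ≤ k
    packing : ∀ u v → u ≢ v → c u ≡ c v → DistGE G u v (suc (c u))

χp≤ : Graph → ℕ → Set
χp≤ G k = PackingColoring G k

χp≡ : Graph → ℕ → Set
χp≡ G k = PackingColoring G k × (∀ j → j < k → ¬ PackingColoring G j)

next6 : Fin 6 → Fin 6
next6 f0 = fs f0
next6 (fs f0) = fs (fs f0)
next6 (fs (fs f0)) = fs (fs (fs f0))
next6 (fs (fs (fs f0))) = fs (fs (fs (fs f0)))
next6 (fs (fs (fs (fs f0)))) = fs (fs (fs (fs (fs f0))))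
next6 (fs (fs (fs (fs (fs f0))))) = f0

-- Vertex (i , j): copy i (0-based, i < t) of C_6, cycle position j.
-- Cycle positions 0,1,2 of copy i are the path vertices v_{3i+1}, v_{3i+2}, v_{3i+3};
-- positions 3,4,5 are the remaining vertices of that copy of C_6.
data PC6Arc (t : ℕ) : Fin t × Fin 6 → Fin t × Fin 6 → Set where
  -- edges of the i-th copy of C_6 (includes the path edges inside a block)
  cyc  : ∀ i j → PC6Arc t (i , j) (i , next6 j)
  -- path edge v_{3i+3} v_{3i+4} joining consecutive copies
  link : ∀ i i' → toℕ i' ≡ suc (toℕ i) → PC6Arc t (i , fs (fs f0)) (i' , f0)

P3tDiamond3C6 : ℕ → Graph
P3tDiamond3C6 t = record { V = Fin t × Fin 6 ; Arc = PC6Arc t }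

{-# OPTIONS --safe #-}
module Submission where

-- Walks map to walks under a graph homomorphism φ : G → H, so a packing coloring of H pulls
-- back to G as soon as distinct vertices with the same image are farther apart than the
-- largest color. Folding the blocks of P_{3t} ◇_3 C_6 by parity maps it onto C_6 ◇_3 C_6,
-- which has a 5-coloring alternating two block patterns; vertices with the same image occupy
-- the same cycle position in distinct blocks of equal parity, so the 1-Lipschitz coordinate
-- 3 i + offset j along the path puts them at distance at least 6. For t ≤ 2 the graph embeds into
-- P_6 ◇_3 C_6, which has a 4-coloring, and its first block is a C_6, which has no packing
-- 3-coloring. The finitely many colorings involved are checked by evaluation.

open import Defs
open import Data.Nat using (ℕ; zero; suc; _+_; _*_; _≤_; _<_; ∣_-_∣; z≤n; s≤s; _≤?_; parity)
open import Data.Nat.Properties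
  using (≤-refl; ≤-trans; ≤-reflexive; <-≤-trans; <⇒≱; +-mono-≤; *-monoʳ-≤; +-comm; +-identityʳ; *-suc;
         ∣n-n∣≡0; ∣m+n-m+o∣≡∣n-o∣; ∣-∣-comm; ∣-∣-triangle; *-distribˡ-∣-∣)
import Data.Nat.Properties as ℕ
open import Data.Nat.GeneralisedArithmetic using (iterate)
open import Data.Parity.Base using (Parity; 0ℙ; 1ℙ; _⁻¹)
import Data.Parity.Properties as Parity
open import Data.Fin using (Fin; toℕ; fromℕ<; inject≤)
open import Data.Fin.Patterns using (0F; 1F; 2F; 3F; 4F; 5F)
open import Data.Fin.Properties using (all?; any?; toℕ-injective; toℕ-fromℕ<; toℕ-inject≤; inject≤-injective)
import Data.Fin.Properties as Fin
open import Data.Product using (_×_; _,_; proj₁; proj₂; ∃₂)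
open import Data.Product.Properties using (≡-dec; ,-injective)
open import Data.Sum using (_⊎_; inj₁; inj₂; swap)
open import Data.Bool using (Bool; T)
open import Data.Bool.ListAction using (any)
open import Data.List using (List; []; _∷_; upTo; allFin; cartesianProduct)
open import Data.List.Membership.Propositional using (_∈_; lose)
open import Data.List.Membership.Propositional.Properties using (∈-allFin; ∈-cartesianProduct⁺; ∈-upTo⁺)
open import Data.List.Relation.Unary.All as All using (All)
open import Data.List.Relation.Unary.Any using (here; there)
open import Data.List.Relation.Unary.Any.Properties using (any⁺)
open import Data.Vec using (Vec; []; _∷_; lookup; tabulate)
open import Data.Vec.Properties using (lookup∘tabulate)
open import Function using (_∘_; Injective)
open import Relation.Binary using (DecidableEquality)
open import Relation.Binary.PropositionalEquality
  using (_≡_; _≢_; _≗_; refl; sym; trans; cong; cong₂; subst; module ≡-Reasoning)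
open import Relation.Nullary using (¬_; Dec; yes; no; map′; ¬?; contradiction)
open import Relation.Nullary.Decidable using (True; isYes; toWitness; fromWitness; T?; _×-dec_; _⊎-dec_; _→-dec_)

record Homomorphism (G H : Graph) : Set where
  field
    ⟦_⟧       : Graph.V G → Graph.V H
    preserves : ∀ {u w} → Graph.Arc G u w → Graph.Adj H ⟦ u ⟧ ⟦ w ⟧

  preserves-adj : ∀ {u w} → Graph.Adj G u w → Graph.Adj H ⟦ u ⟧ ⟦ w ⟧
  preserves-adj (inj₁ a) = preserves a
  preserves-adj (inj₂ a) = swap (preserves a)

  map-walk : ∀ {u v n} → Walk G u v n → Walk H ⟦ u ⟧ ⟦ v ⟧ n
  map-walk nil        = nil
  map-walk (cons a w) = cons (preserves-adj a) (map-walk w)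

  reflects-DistGE : ∀ {u v d} → DistGE H ⟦ u ⟧ ⟦ v ⟧ d → DistGE G u v d
  reflects-DistGE far n n<d = far n n<d ∘ map-walk

DistGE-weaken : ∀ {G u v d e} → d ≤ e → DistGE G u v e → DistGE G u v d
DistGE-weaken d≤e far n n<d = far n (<-≤-trans n<d d≤e)

PackingColoring-weaken : ∀ {G j k} → j ≤ k → PackingColoring G j → PackingColoring G k
PackingColoring-weaken j≤k P = record
  { c = c ; c-pos = c-pos ; c-bound = λ v → ≤-trans (c-bound v) j≤k ; packing = packing }
  where open PackingColoring P

module _ {G H : Graph} (φ : Homomorphism G H) where
  open Homomorphism φ

  pullback : ∀ {k} → (∀ {u v} → u ≢ v → ⟦ u ⟧ ≢ ⟦ v ⟧ ⊎ DistGE G u v (suc k)) →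
             PackingColoring H k → PackingColoring G k
  pullback separated P = record
    { c       = c ∘ ⟦_⟧
    ; c-pos   = c-pos ∘ ⟦_⟧
    ; c-bound = c-bound ∘ ⟦_⟧
    ; packing = packing′
    }
    where
      open PackingColoring P
      packing′ : ∀ u v → u ≢ v → c ⟦ u ⟧ ≡ c ⟦ v ⟧ → DistGE G u v (suc (c ⟦ u ⟧))
      packing′ u v u≢v same with separated u≢v
      ... | inj₁ images-differ = reflects-DistGE (packing ⟦ u ⟧ ⟦ v ⟧ images-differ same)
      ... | inj₂ far           = DistGE-weaken (s≤s (c-bound ⟦ u ⟧)) far

  pullback-injective : ∀ {k} → Injective _≡_ _≡_ ⟦_⟧ → PackingColoring H k → PackingColoring G k
  pullback-injective injective = pullback (λ u≢v → inj₁ (u≢v ∘ injective))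

module Certify
  (H : Graph)
  (_≟_ : DecidableEquality (Graph.V H))
  (vertices : List (Graph.V H))
  (∈-vertices : ∀ v → v ∈ vertices)
  (neighbors : Graph.V H → List (Graph.V H))
  (adj⇒∈neighbors : ∀ {u w} → Graph.Adj H u w → w ∈ neighbors u)
  where

  private
    V = Graph.V H

  -- Only an over-approximation of walk existence: `neighbors` may list non-neighbors.
  reachable : ℕ → V → V → Bool
  reachable zero    u v = isYes (u ≟ v)
  reachable (suc n) u v = any (λ w → reachable n w v) (neighbors u)

  walk⇒reachable : ∀ {u v n} → Walk H u v n → T (reachable n u v)
  walk⇒reachable nil        = fromWitness refl
  walk⇒reachable (cons a w) = any⁺ _ (lose (adj⇒∈neighbors a) (walk⇒reachable w))

  Unreachable : ℕ → V → V → Set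
  Unreachable d u v = All (λ n → ¬ T (reachable n u v)) (upTo d)

  Unreachable⇒DistGE : ∀ {d u v} → Unreachable d u v → DistGE H u v d
  Unreachable⇒DistGE unreachable n n<d w = All.lookup unreachable (∈-upTo⁺ n<d) (walk⇒reachable w)

  Packed : (V → ℕ) → V → V → Set
  Packed c u v = u ≡ v ⊎ c u ≢ c v ⊎ Unreachable (suc (c u)) u v

  packed? : ∀ c u v → Dec (Packed c u v)
  packed? c u v = u ≟ v ⊎-dec ¬? (c u ℕ.≟ c v) ⊎-dec All.all? (λ n → ¬? (T? _)) (upTo (suc (c u)))

  Certificate : (V → ℕ) → ℕ → Set
  Certificate c k = All (λ u → 1 ≤ c u × c u ≤ k × All (Packed c u) vertices) vertices

  certificate? : ∀ c k → Dec (Certificate c k)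
  certificate? c k = All.all? (λ u → 1 ≤? c u ×-dec c u ≤? k ×-dec All.all? (packed? c u) vertices) vertices

  certified : ∀ c k → True (certificate? c k) → PackingColoring H k
  certified c k ok = record
    { c       = c
    ; c-pos   = proj₁ ∘ at
    ; c-bound = proj₁ ∘ proj₂ ∘ at
    ; packing = packing
    }
    where
      at : ∀ u → 1 ≤ c u × c u ≤ k × All (Packed c u) vertices
      at u = All.lookup (toWitness ok) (∈-vertices u)

      packing : ∀ u v → u ≢ v → c u ≡ c v → DistGE H u v (suc (c u))
      packing u v u≢v same with All.lookup (proj₂ (proj₂ (at u))) (∈-vertices v)
      ... | inj₁ u≡v                = contradiction u≡v u≢v
      ... | inj₂ (inj₁ differ)      = contradiction same differ
      ... | inj₂ (inj₂ unreachable) = Unreachable⇒DistGE unreachable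

infixl 6 _⊕_

_⊕_ : Fin 6 → ℕ → Fin 6
x ⊕ m = iterate next6 x m

prev6 : Fin 6 → Fin 6
prev6 x = x ⊕ 5

prev6-next6 : ∀ x → prev6 (next6 x) ≡ x
prev6-next6 0F = refl
prev6-next6 1F = refl
prev6-next6 2F = refl
prev6-next6 3F = refl
prev6-next6 4F = refl
prev6-next6 5F = refl

C₆ : Graph
C₆ = record { V = Fin 6 ; Arc = λ x y → y ≡ next6 x }

walk-around : ∀ x m → Walk C₆ x (x ⊕ m) m
walk-around x zero    = nil
walk-around x (suc m) = cons (inj₁ refl) (walk-around (next6 x) m)

Clash : (Fin 6 → ℕ) → Set
Clash c = ∃₂ λ x (m : Fin 4) → x ≢ x ⊕ toℕ m × c x ≡ c (x ⊕ toℕ m) × toℕ m ≤ c x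

clash? : ∀ c → Dec (Clash c)
clash? c = any? λ x → any? λ m →
  ¬? (x Fin.≟ x ⊕ toℕ m) ×-dec c x ℕ.≟ c (x ⊕ toℕ m) ×-dec toℕ m ≤? c x

Clash-resp : ∀ {c c′} → c ≗ c′ → Clash c → Clash c′
Clash-resp c≗c′ (x , m , x≢y , same , m≤c) =
  x , m , x≢y , trans (sym (c≗c′ x)) (trans same (c≗c′ _)) , subst (toℕ m ≤_) (c≗c′ x) m≤c

packing⇒¬Clash : ∀ {k} (P : PackingColoring C₆ k) → ¬ Clash (PackingColoring.c P)
packing⇒¬Clash P (x , m , x≢y , same , m≤c) =
  PackingColoring.packing P x _ x≢y same (toℕ m) (s≤s m≤c) (walk-around x (toℕ m))

∀-Vec? : ∀ {m} n {P : Vec (Fin m) n → Set} → (∀ v → Dec (P v)) → Dec (∀ v → P v)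
∀-Vec? zero    P? = map′ (λ { p [] → p }) (λ h → h []) (P? [])
∀-Vec? (suc n) P? =
  map′ (λ { h (x ∷ v) → h x v }) (λ h x v → h (x ∷ v)) (all? λ x → ∀-Vec? n (P? ∘ (x ∷_)))

every-3-coloring-clashes : ∀ (a : Vec (Fin 4) 6) → (∀ x → 1 ≤ toℕ (lookup a x)) → Clash (toℕ ∘ lookup a)
every-3-coloring-clashes = toWitness {a? = ∀-Vec? 6 λ a → all? (λ x → 1 ≤? _) →-dec clash? _} _

C₆-not-3-colorable : ¬ PackingColoring C₆ 3
C₆-not-3-colorable P = packing⇒¬Clash P (Clash-resp values (every-3-coloring-clashes a positive))
  where
    open PackingColoring P
    color : Fin 6 → Fin 4
    color x = fromℕ< (s≤s (c-bound x))
    a : Vec (Fin 4) 6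
    a = tabulate color
    values : toℕ ∘ lookup a ≗ c
    values x = trans (cong toℕ (lookup∘tabulate color x)) (toℕ-fromℕ< (s≤s (c-bound x)))
    positive : ∀ x → 1 ≤ toℕ (lookup a x)
    positive x = subst (1 ≤_) (sym (values x)) (c-pos x)

block₀ : ∀ {t} → Homomorphism C₆ (P3tDiamond3C6 (suc t))
block₀ = record { ⟦_⟧ = 0F ,_ ; preserves = λ { refl → inj₁ (cyc 0F _) } }

χp≥4 : ∀ {t} → 1 ≤ t → ∀ j → j < 4 → ¬ PackingColoring (P3tDiamond3C6 t) j
χp≥4 {suc t} _ j (s≤s j≤3) =
  C₆-not-3-colorable ∘ pullback-injective block₀ (proj₂ ∘ ,-injective) ∘ PackingColoring-weaken j≤3

embed : ∀ {s t} → s ≤ t → Homomorphism (P3tDiamond3C6 s) (P3tDiamond3C6 t)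
embed {s} {t} s≤t = record { ⟦_⟧ = inject ; preserves = preserves }
  where
    inject : Fin s × Fin 6 → Fin t × Fin 6
    inject (i , j) = inject≤ i s≤t , j
    preserves : ∀ {u w} → PC6Arc s u w → Graph.Adj (P3tDiamond3C6 t) (inject u) (inject w)
    preserves (cyc i j)      = inj₁ (cyc _ j)
    preserves (link i i′ e) =
      inj₁ (link _ _ (trans (toℕ-inject≤ i′ s≤t) (trans e (cong suc (sym (toℕ-inject≤ i s≤t))))))

embed-injective : ∀ {s t} (s≤t : s ≤ t) → Injective _≡_ _≡_ (Homomorphism.⟦_⟧ (embed s≤t))
embed-injective s≤t {i , j} {i′ , _} eq with ,-injective eq
... | i≡i′ , refl = cong (_, j) (inject≤-injective s≤t s≤t i i′ i≡i′)

links₂ : Fin 2 × Fin 6 → List (Fin 2 × Fin 6)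
links₂ (0F , 2F) = (1F , 0F) ∷ []
links₂ (1F , 0F) = (0F , 2F) ∷ []
links₂ _         = []

neighbors₂ : Fin 2 × Fin 6 → List (Fin 2 × Fin 6)
neighbors₂ (i , j) = (i , next6 j) ∷ (i , prev6 j) ∷ links₂ (i , j)

adj⇒∈neighbors₂ : ∀ {u w} → Graph.Adj (P3tDiamond3C6 2) u w → w ∈ neighbors₂ u
adj⇒∈neighbors₂ (inj₁ (cyc i j))          = here refl
adj⇒∈neighbors₂ (inj₂ (cyc i j))          = there (here (cong (i ,_) (sym (prev6-next6 j))))
adj⇒∈neighbors₂ (inj₁ (link 0F 1F refl)) = there (there (here refl))
adj⇒∈neighbors₂ (inj₂ (link 0F 1F refl)) = there (there (here refl))

vertices₂ : List (Fin 2 × Fin 6)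
vertices₂ = cartesianProduct (allFin 2) (allFin 6)

∈-vertices₂ : ∀ v → v ∈ vertices₂
∈-vertices₂ (i , j) = ∈-cartesianProduct⁺ (∈-allFin i) (∈-allFin j)

coloring₂ : Fin 2 × Fin 6 → ℕ
coloring₂ (0F , j) = lookup (1 ∷ 2 ∷ 1 ∷ 4 ∷ 1 ∷ 3 ∷ []) j
coloring₂ (1F , j) = lookup (3 ∷ 1 ∷ 2 ∷ 4 ∷ 1 ∷ 2 ∷ []) j

χp[P6◇C6]≤4 : PackingColoring (P3tDiamond3C6 2) 4
χp[P6◇C6]≤4 = certified coloring₂ 4 _
  where
    open Certify (P3tDiamond3C6 2) (≡-dec Fin._≟_ Fin._≟_) vertices₂ ∈-vertices₂ neighbors₂ adj⇒∈neighbors₂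

χp≤4 : ∀ {t} → t ≤ 2 → PackingColoring (P3tDiamond3C6 t) 4
χp≤4 t≤2 = pullback-injective (embed t≤2) (embed-injective t≤2) χp[P6◇C6]≤4

data C6Diamond3C6Arc : Parity × Fin 6 → Parity × Fin 6 → Set where
  cyc  : ∀ p j → C6Diamond3C6Arc (p , j) (p , next6 j)
  link : ∀ p p′ → p′ ≡ p ⁻¹ → C6Diamond3C6Arc (p , 2F) (p′ , 0F)

C6Diamond3C6 : Graph
C6Diamond3C6 = record { V = Parity × Fin 6 ; Arc = C6Diamond3C6Arc }

_≟ᶜ_ : DecidableEquality (Parity × Fin 6)
_≟ᶜ_ = ≡-dec Parity._≟_ Fin._≟_

parity-suc : ∀ n → parity (suc n) ≡ parity n ⁻¹
parity-suc n = sym (Parity.⁻¹-selfInverse (Parity.suc-homo-⁻¹ n))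

byParity : ∀ {t} → Fin t × Fin 6 → Parity × Fin 6
byParity (i , j) = parity (toℕ i) , j

fold : ∀ {t} → Homomorphism (P3tDiamond3C6 t) C6Diamond3C6
fold {t} = record { ⟦_⟧ = byParity ; preserves = preserves }
  where
    preserves : ∀ {u w} → PC6Arc t u w → Graph.Adj C6Diamond3C6 (byParity u) (byParity w)
    preserves (cyc i j)      = inj₁ (cyc _ j)
    preserves (link i i′ e) = inj₁ (link _ _ (trans (cong parity e) (parity-suc (toℕ i))))

-- The position along the path P_{3t}; the off-path vertices 3, 4, 5 of a block sit above 2, 1, 0.
offset : Fin 6 → ℕ
offset 0F = 0
offset 1F = 1
offset 2F = 2
offset 3F = 2
offset 4F = 1
offset 5F = 0

pathCoord : ∀ {t} → Fin t × Fin 6 → ℕ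
pathCoord (i , j) = 3 * toℕ i + offset j

offset-next6 : ∀ j → ∣ offset j - offset (next6 j) ∣ ≤ 1
offset-next6 0F = ≤-refl
offset-next6 1F = ≤-refl
offset-next6 2F = z≤n
offset-next6 3F = ≤-refl
offset-next6 4F = ≤-refl
offset-next6 5F = z≤n

pathCoord-arc : ∀ {t u w} → PC6Arc t u w → ∣ pathCoord u - pathCoord w ∣ ≤ 1
pathCoord-arc (cyc i j) = ≤-trans (≤-reflexive (∣m+n-m+o∣≡∣n-o∣ (3 * toℕ i) _ _)) (offset-next6 j)
pathCoord-arc (link i i′ e) = ≤-reflexive (begin
  ∣ 3 * a + 2 - 3 * toℕ i′ + 0 ∣ ≡⟨ cong (λ b → ∣ 3 * a + 2 - b ∣) next-block ⟩
  ∣ 3 * a + 2 - 3 * a + 3 ∣     ≡⟨ ∣m+n-m+o∣≡∣n-o∣ (3 * a) 2 3 ⟩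
  1                             ∎)
  where
    open ≡-Reasoning
    a = toℕ i
    next-block : 3 * toℕ i′ + 0 ≡ 3 * a + 3
    next-block = trans (+-identityʳ _) (trans (cong (3 *_) e) (trans (*-suc 3 a) (+-comm 3 (3 * a))))

pathCoord-adj : ∀ {t u w} → Graph.Adj (P3tDiamond3C6 t) u w → ∣ pathCoord u - pathCoord w ∣ ≤ 1
pathCoord-adj         (inj₁ a) = pathCoord-arc a
pathCoord-adj {u = u} {w} (inj₂ a) = subst (_≤ 1) (∣-∣-comm (pathCoord w) (pathCoord u)) (pathCoord-arc a)

pathCoord-walk : ∀ {t u v n} → Walk (P3tDiamond3C6 t) u v n → ∣ pathCoord u - pathCoord v ∣ ≤ n
pathCoord-walk {u = u} nil = ≤-reflexive (∣n-n∣≡0 (pathCoord u))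
pathCoord-walk {u = u} {v} (cons {w = w} a walk) =
  ≤-trans (∣-∣-triangle (pathCoord u) (pathCoord w) (pathCoord v)) (+-mono-≤ (pathCoord-adj a) (pathCoord-walk walk))

same-parity⇒∣-∣≥2 : ∀ m n → m ≢ n → parity m ≡ parity n → 2 ≤ ∣ m - n ∣
same-parity⇒∣-∣≥2 zero          zero          m≢n _  = contradiction refl m≢n
same-parity⇒∣-∣≥2 zero          (suc (suc n)) _   _  = s≤s (s≤s z≤n)
same-parity⇒∣-∣≥2 (suc (suc m)) zero          _   _  = s≤s (s≤s z≤n)
same-parity⇒∣-∣≥2 (suc m)       (suc n)       m≢n eq =
  same-parity⇒∣-∣≥2 m n (m≢n ∘ cong suc) (Parity.⁻¹-injective (trans (sym (parity-suc m)) (trans eq (parity-suc n))))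

byParity-fibres-far : ∀ {t} {u v : Fin t × Fin 6} → u ≢ v → byParity u ≡ byParity v → DistGE (P3tDiamond3C6 t) u v 6
byParity-fibres-far {u = i , j} {i′ , _} u≢v same n n<6 walk with ,-injective same
... | same-parity , refl = <⇒≱ n<6 (begin
  6                                       ≤⟨ *-monoʳ-≤ 3 (same-parity⇒∣-∣≥2 a b a≢b same-parity) ⟩
  3 * ∣ a - b ∣                           ≡⟨ *-distribˡ-∣-∣ 3 a b ⟩
  ∣ 3 * a - 3 * b ∣                       ≡⟨ ∣m+n-m+o∣≡∣n-o∣ (offset j) (3 * a) (3 * b) ⟨
  ∣ offset j + 3 * a - offset j + 3 * b ∣ ≡⟨ cong₂ ∣_-_∣ (+-comm (offset j) (3 * a)) (+-comm (offset j) (3 * b)) ⟩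
  ∣ 3 * a + offset j - 3 * b + offset j ∣ ≤⟨ pathCoord-walk walk ⟩
  n                                       ∎)
  where
    open ℕ.≤-Reasoning
    a = toℕ i
    b = toℕ i′
    a≢b : a ≢ b
    a≢b a≡b = u≢v (cong (_, j) (toℕ-injective a≡b))

linksᶜ : Parity × Fin 6 → List (Parity × Fin 6)
linksᶜ (p , 2F) = (p ⁻¹ , 0F) ∷ []
linksᶜ (p , 0F) = (p ⁻¹ , 2F) ∷ []
linksᶜ _        = []

neighborsᶜ : Parity × Fin 6 → List (Parity × Fin 6)
neighborsᶜ (p , j) = (p , next6 j) ∷ (p , prev6 j) ∷ linksᶜ (p , j)

adj⇒∈neighborsᶜ : ∀ {u w} → Graph.Adj C6Diamond3C6 u w → w ∈ neighborsᶜ u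
adj⇒∈neighborsᶜ (inj₁ (cyc p j))       = here refl
adj⇒∈neighborsᶜ (inj₂ (cyc p j))       = there (here (cong (p ,_) (sym (prev6-next6 j))))
adj⇒∈neighborsᶜ (inj₁ (link p _ refl)) = there (there (here refl))
adj⇒∈neighborsᶜ (inj₂ (link p _ refl)) = there (there (here (cong (_, 2F) (sym (Parity.⁻¹-involutive p)))))

parities : List Parity
parities = 0ℙ ∷ 1ℙ ∷ []

∈-parities : ∀ p → p ∈ parities
∈-parities 0ℙ = here refl
∈-parities 1ℙ = there (here refl)

verticesᶜ : List (Parity × Fin 6)
verticesᶜ = cartesianProduct parities (allFin 6)

∈-verticesᶜ : ∀ v → v ∈ verticesᶜ
∈-verticesᶜ (p , j) = ∈-cartesianProduct⁺ (∈-parities p) (∈-allFin j)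

alternatingColoring : Parity × Fin 6 → ℕ
alternatingColoring (0ℙ , j) = lookup (1 ∷ 2 ∷ 1 ∷ 3 ∷ 1 ∷ 4 ∷ []) j
alternatingColoring (1ℙ , j) = lookup (5 ∷ 1 ∷ 3 ∷ 1 ∷ 2 ∷ 1 ∷ []) j

χp[C6◇C6]≤5 : PackingColoring C6Diamond3C6 5
χp[C6◇C6]≤5 = certified alternatingColoring 5 _
  where open Certify C6Diamond3C6 _≟ᶜ_ verticesᶜ ∈-verticesᶜ neighborsᶜ adj⇒∈neighborsᶜ

χp≤5 : ∀ t → PackingColoring (P3tDiamond3C6 t) 5
χp≤5 t = pullback fold separated χp[C6◇C6]≤5
  where
    separated : ∀ {u v} → u ≢ v → byParity u ≢ byParity v ⊎ DistGE (P3tDiamond3C6 t) u v 6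
    separated {u} {v} u≢v with byParity u ≟ᶜ byParity v
    ... | yes same     = inj₂ (byParity-fibres-far u≢v same)
    ... | no different = inj₁ different

theorem8 : (∀ (t : ℕ) → 1 ≤ t → t ≤ 2 → χp≤ (P3tDiamond3C6 t) 4)
             × (∀ (t : ℕ) → 3 ≤ t → χp≤ (P3tDiamond3C6 t) 5)
             × (∀ (t : ℕ) → t ≡ 1 ⊎ t ≡ 2 → χp≡ (P3tDiamond3C6 t) 4)
theorem8 = (λ _ _ t≤2 → χp≤4 t≤2) , (λ t _ → χp≤5 t) , exact
  where
    exact : ∀ t → t ≡ 1 ⊎ t ≡ 2 → χp≡ (P3tDiamond3C6 t) 4
    exact _ (inj₁ refl) = χp≤4 (s≤s z≤n) , χp≥4 (s≤s z≤n)
    exact _ (inj₂ refl) = χp≤4 ≤-refl , χp≥4 (s≤s z≤n)
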